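{- Let $M$ be a sharp, integral monoid and let $\phi:\Gamma\to\Gamma'$ be a harmonic, non-degenerate morphism of $M$-metrised graphs. Then for every effective divisor $D'\in\operatorname{Div}(\Gamma')$ we have $r(\phi^*(D'))\ge r(D')$.
   Context: Monoids: commutative, sharp, integral; $M^{gp}$ groupification. A graph is $(X,r,i)$: $X$ finite, $r$ idempotent, $i$ involution, $i(x)=x\iff r(x)=x$; vertices $V$ = fixed points, half-edges $H=X\setminus V$, $H_v=\{e:r(e)=v\}$; connected. $M$-metrised: $l:X\to M$, $l\circ i=l$, $l(x)=0\iff x\in V$. $\operatorname{Div}(\Gamma)$ free abelian group on $V$; $\operatorname{PL}(\Gamma)=\{g:V\to M^{gp}: g(r(e))-g(r(i(e)))\in\langle l(e)\rangle\}$; $\Delta(g)=\sum_v\sum_{e\in H_v}\frac{g(v)-g(r(i(e)))}{l(e)}[v]$; $D\sim D'$ iff $D-D'\in\Delta(\operatorname{PL}(\Gamma))$; $|D|=\{E\ge0:E\sim D\}$; $r(D)=\max\{k\in\mathbb Z:|D-F|\ne\emptyset$ for all effective $F$ of degree $k\}$. A morphism $\phi:X\to X'$ sends vertices to vertices and each half-edge $e$ either to a half-edge $e'$ with $\phi(r(e))=r'(e')$, $\phi(r(i(e)))=r'(i'(e'))$, $l'(e')\in\langle l(e)\rangle$, or to a vertex $v'$ with $\phi(r(e))=\phi(r(i(e)))=v'$. Slope $\mu_\phi(e)=l'(\phi(e))/l(e)$ or $0$; $m_{\phi,v}(e')=\sum_{e\in H_v,\phi(e)=e'}\mu_\phi(e)$;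 harmonic: independent of $e'\in H'_{\phi(v)}$, value $m_\phi(v)$; non-degenerate: $m_\phi(v)>0$ for all $v$. $\phi^*(D')=\sum_vD'(\phi(v))m_\phi(v)[v]$. -}

module Defs where

open import Level using (_⊔_)
open import Algebra.Bundles using (CommutativeMonoid)
open import Data.Nat as ℕ using (ℕ; zero; suc)
open import Data.Integer as ℤ using (ℤ; +_; -[1+_])
open import Data.Fin as F using (Fin; _≟_)
open import Data.Product using (Σ; ∃; ∃-syntax; _×_; _,_)
open import Data.Sum using (_⊎_)
open import Relation.Nullary using (¬_; Dec; yes; no)
open import Relation.Binary.PropositionalEquality using (_≡_; _≢_)
open import Relation.Binary.Construct.Closure.Equivalence using (EqClosure)
open import Function using (_∘_)

sumFin : ∀ {n} → (Fin n → ℤ) → ℤ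
sumFin {zero} f = + 0
sumFin {suc n} f = f F.zero ℤ.+ sumFin (f ∘ F.suc)

when : ∀ {p} {P : Set p} → Dec P → ℤ → ℤ
when (yes _) z = z
when (no _) z = + 0

unless : ∀ {p} {P : Set p} → Dec P → ℤ → ℤ
unless (yes _) z = + 0
unless (no _) z = z

module _ {c ℓ} (M : CommutativeMonoid c ℓ) where
  open CommutativeMonoid M renaming (Carrier to A)

  Sharp : Set (c ⊔ ℓ)
  Sharp = ∀ x y → (x ∙ y) ≈ ε → x ≈ ε

  -- integral: M → M^gp injective, i.e. M cancellative
  Integral : Set (c ⊔ ℓ)
  Integral = ∀ x y z → (x ∙ z) ≈ (y ∙ z) → x ≈ y

  _×ₘ_ : ℕ → A → A
  zero ×ₘ a = ε
  suc k ×ₘ a = a ∙ (k ×ₘ a)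

  -- groupification M^gp: formal differences (a , b) = a - b
  Gp : Set c
  Gp = A × A

  _≈ᵍ_ : Gp → Gp → Set (c ⊔ ℓ)
  (a , b) ≈ᵍ (a' , b') = ∃[ z ] (((a ∙ b') ∙ z) ≈ ((a' ∙ b) ∙ z))

  _-ᵍ_ : Gp → Gp → Gp
  (a , b) -ᵍ (a' , b') = (a ∙ b') , (b ∙ a')

  ι : A → Gp
  ι a = a , ε

  _·ᵍ_ : ℤ → Gp → Gp
  (+ k) ·ᵍ (a , b) = (k ×ₘ a) , (k ×ₘ b)
  -[1+ k ] ·ᵍ (a , b) = (suc k ×ₘ b) , (suc k ×ₘ a)

  record MGraph : Set (c ⊔ ℓ) where
    field
      n        : ℕ
      r        : Fin n → Fin n
      i        : Fin n → Fin n
      r-idem   : ∀ x → r (r x) ≡ r x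
      i-invol  : ∀ x → i (i x) ≡ x
      i-fix⇒r  : ∀ x → i x ≡ x → r x ≡ x
      r-fix⇒i  : ∀ x → r x ≡ x → i x ≡ x
      connected : ∀ x y → EqClosure (λ a b → (b ≡ r a) ⊎ (b ≡ i a)) x y
      l        : Fin n → A
      l-sym    : ∀ x → l (i x) ≈ l x
      l-zero⇒  : ∀ x → l x ≈ ε → r x ≡ x
      ⇒l-zero  : ∀ x → r x ≡ x → l x ≈ ε

  module _ (Γ : MGraph) where
    open MGraph Γ

    IsVertex : Fin n → Set
    IsVertex x = r x ≡ x

    IsHalfEdge : Fin n → Set
    IsHalfEdge x = r x ≢ x

    -- Divisors: integer values at the vertices (values at half-edges are ignored).
    Div : Set
    Div = Fin n → ℤ

    Effective : Div → Set
    Effective D = ∀ v → IsVertex v → + 0 ℤ.≤ D v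

    deg : Div → ℤ
    deg D = sumFin (λ x → when (r x ≟ x) (D x))

    -- sum over e ∈ H_v of f e
    sumH : Fin n → (Fin n → ℤ) → ℤ
    sumH v f = sumFin (λ e → when (r e ≟ v) (unless (e ≟ v) (f e)))

    -- D = Δ(g) with g ∈ PL(Γ): s e is the integer (g(r e) - g(r(i e))) / l(e)
    IsLaplacian : (Fin n → Gp) → Div → Set (c ⊔ ℓ)
    IsLaplacian g D =
      ∃[ s ] ( (∀ e → IsHalfEdge e → (g (r e) -ᵍ g (r (i e))) ≈ᵍ (s e ·ᵍ ι (l e)))
             × (∀ v → IsVertex v → D v ≡ sumH v s) )

    _∼_ : Div → Div → Set (c ⊔ ℓ)
    D ∼ D' = ∃[ g ] IsLaplacian g (λ x → D x ℤ.- D' x)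

    LinSysNonempty : Div → Set (c ⊔ ℓ)
    LinSysNonempty D = ∃[ E ] (Effective E × E ∼ D)

    RankAtLeast : Div → ℤ → Set (c ⊔ ℓ)
    RankAtLeast D k = ∀ F → Effective F → deg F ≡ k → LinSysNonempty (λ x → D x ℤ.- F x)

    IsRank : Div → ℤ → Set (c ⊔ ℓ)
    IsRank D ρ = RankAtLeast D ρ × (∀ k → RankAtLeast D k → k ℤ.≤ ρ)

  module _ (Γ Γ' : MGraph) (φ : Fin (MGraph.n Γ) → Fin (MGraph.n Γ')) where
    open MGraph Γ
    open MGraph Γ' renaming (n to n'; r to r'; i to i'; l to l') using ()

    IsMorphism : Set ℓ
    IsMorphism =
      (∀ v → IsVertex Γ v → IsVertex Γ' (φ v))
      × (∀ e → IsHalfEdge Γ e →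
           ( IsHalfEdge Γ' (φ e) × φ (r e) ≡ r' (φ e) × φ (r (i e)) ≡ r' (i' (φ e))
             × ∃[ k ] (l' (φ e) ≈ (k ×ₘ l e)) )
         ⊎ ( IsVertex Γ' (φ e) × φ (r e) ≡ φ e × φ (r (i e)) ≡ φ e ))

    IsSlope : (Fin n → ℕ) → Set ℓ
    IsSlope μ = ∀ e → IsHalfEdge Γ e →
      (IsHalfEdge Γ' (φ e) → l' (φ e) ≈ (μ e ×ₘ l e))
      × (IsVertex Γ' (φ e) → μ e ≡ 0)

    localDeg : (Fin n → ℕ) → Fin n → Fin n' → ℤ
    localDeg μ v e' = sumH Γ v (λ e → when (φ e ≟ e') (+ μ e))

    IsHarmonicWith : (Fin n → ℕ) → (Fin n → ℕ) → Set
    IsHarmonicWith μ m = ∀ v → IsVertex Γ v → ∀ e' → IsHalfEdge Γ' e' → r' e' ≡ φ v →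
      localDeg μ v e' ≡ + m v

    NonDegenerate : (Fin n → ℕ) → Set
    NonDegenerate m = ∀ v → IsVertex Γ v → 0 ℕ.< m v

    pullback : (Fin n → ℕ) → Div Γ' → Div Γ
    pullback m D' v = D' (φ v) ℤ.* + m v

-- Given an effective F of degree k on Γ, push it forward to φ₊F on Γ', which is effective of the
-- same degree. If r(D') ≥ k there is an effective E' with E' − D' + φ₊F = Δg'. Harmonicity makes
-- pulling back commute with the Laplacian, φ*(Δg') = Δ(g' ∘ φ), so
-- φ*E' + (φ*φ₊F − F) ∼ φ*D' − F, and this divisor is effective because non-degeneracy gives
-- F ≤ φ*φ₊F. Hence r(φ*D') ≥ k as well.
module Submission where

open import Defs
open import Algebra.Bundles using (CommutativeMonoid)
open import Data.Nat using (ℕ)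
open import Data.Integer using (ℤ; _≤_)
open import Data.Fin using (Fin)

open import Data.Nat as ℕ using (zero; suc)
import Data.Nat.Properties as ℕP
open import Data.Integer as ℤ using (+_; -[1+_])
import Data.Integer.Properties as ℤP
open import Data.Integer.Tactic.RingSolver using (solve-∀)
open import Data.Fin as F using (_≟_)
import Data.Fin.Properties as FP
open import Data.Product using (_,_; proj₁; proj₂)
open import Data.Sum using (inj₁; inj₂)
open import Data.Empty using (⊥-elim)
open import Relation.Nullary using (¬_; Dec; yes; no)
open import Relation.Binary.PropositionalEquality
  using (_≡_; _≢_; refl; sym; trans; cong; cong₂; subst; module ≡-Reasoning)
open import Function using (_∘_)
open import Algebra.Properties.Semiring.Sum ℤP.+-*-semiring
  using (sum; sum-cong-≗; sum-replicate-zero; ∑-comm; *-distribˡ-sum; *-distribʳ-sum)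

sumFin≗sum : ∀ {n} (f : Fin n → ℤ) → sumFin f ≡ sum f
sumFin≗sum {zero} f = refl
sumFin≗sum {suc n} f = cong (λ t → f F.zero ℤ.+ t) (sumFin≗sum (f ∘ F.suc))

sum-zeros : ∀ {n} (f : Fin n → ℤ) → (∀ x → f x ≡ + 0) → sum f ≡ + 0
sum-zeros {n} f f≗0 = trans (sum-cong-≗ f≗0) (sum-replicate-zero n)

sum-concentrated : ∀ {n} (a : Fin n) (f : Fin n → ℤ) → (∀ x → x ≢ a → f x ≡ + 0) → sum f ≡ f a
sum-concentrated F.zero f off-a =
  trans (cong (λ t → f F.zero ℤ.+ t) (sum-zeros (f ∘ F.suc) (λ x → off-a (F.suc x) λ ())))
        (ℤP.+-identityʳ _)
sum-concentrated (F.suc a) f off-a =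
  trans (cong₂ ℤ._+_ (off-a F.zero λ ()) (sum-concentrated a (f ∘ F.suc) off-a∘suc))
        (ℤP.+-identityˡ _)
  where
  off-a∘suc : ∀ x → x ≢ a → f (F.suc x) ≡ + 0
  off-a∘suc x x≢a = off-a (F.suc x) (x≢a ∘ FP.suc-injective)

sum-nonNeg : ∀ {n} (f : Fin n → ℤ) → (∀ x → + 0 ≤ f x) → + 0 ≤ sum f
sum-nonNeg {zero} f f≥0 = ℤP.≤-refl
sum-nonNeg {suc n} f f≥0 = ℤP.+-mono-≤ (f≥0 F.zero) (sum-nonNeg (f ∘ F.suc) (f≥0 ∘ F.suc))

≤-sum : ∀ {n} (f : Fin n → ℤ) → (∀ x → + 0 ≤ f x) → ∀ a → f a ≤ sum f
≤-sum f f≥0 F.zero =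
  ℤP.≤-trans (ℤP.≤-reflexive (sym (ℤP.+-identityʳ _)))
             (ℤP.+-monoʳ-≤ (f F.zero) (sum-nonNeg (f ∘ F.suc) (f≥0 ∘ F.suc)))
≤-sum f f≥0 (F.suc a) =
  ℤP.≤-trans (≤-sum (f ∘ F.suc) (f≥0 ∘ F.suc) a)
    (ℤP.≤-trans (ℤP.≤-reflexive (sym (ℤP.+-identityˡ _))) (ℤP.+-monoˡ-≤ _ (f≥0 F.zero)))

module _ {p} {P : Set p} where

  when-yes : (d : Dec P) {z : ℤ} → P → when d z ≡ z
  when-yes (yes _) _ = refl
  when-yes (no ¬q) q = ⊥-elim (¬q q)

  when-no : (d : Dec P) {z : ℤ} → ¬ P → when d z ≡ + 0
  when-no (yes q) ¬q = ⊥-elim (¬q q)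
  when-no (no _) _ = refl

  unless-no : (d : Dec P) {z : ℤ} → ¬ P → unless d z ≡ z
  unless-no (yes q) ¬q = ⊥-elim (¬q q)
  unless-no (no _) _ = refl

  when-zero : (d : Dec P) → when d (+ 0) ≡ + 0
  when-zero (yes _) = refl
  when-zero (no _) = refl

  unless-zero : (d : Dec P) → unless d (+ 0) ≡ + 0
  unless-zero (yes _) = refl
  unless-zero (no _) = refl

  when-sum : ∀ {n} (d : Dec P) (f : Fin n → ℤ) → when d (sum f) ≡ sum (λ x → when d (f x))
  when-sum (yes _) f = refl
  when-sum {n} (no _) f = sym (sum-replicate-zero n)

  unless-sum : ∀ {n} (d : Dec P) (f : Fin n → ℤ) → unless d (sum f) ≡ sum (λ x → unless d (f x))
  unless-sum {n} (yes _) f = sym (sum-replicate-zero n)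
  unless-sum (no _) f = refl

  when-nonNeg : (d : Dec P) {z : ℤ} → (P → + 0 ≤ z) → + 0 ≤ when d z
  when-nonNeg (yes q) z≥0 = z≥0 q
  when-nonNeg (no _) _ = ℤP.≤-refl

module Groupification {c ℓ} (M : CommutativeMonoid c ℓ) where
  open CommutativeMonoid M renaming (Carrier to A; refl to ≈-refl; sym to ≈-sym; trans to ≈-trans)
  open import Algebra.Properties.Monoid.Mult monoid using (_×_; ×-congʳ; ×-assocˡ)
  open import Algebra.Solver.CommutativeMonoid M using (solve; _⊕_; _⊜_)

  ×ₘ≗× : ∀ k a → _×ₘ_ M k a ≡ k × a
  ×ₘ≗× zero a = refl
  ×ₘ≗× (suc k) a = cong (a ∙_) (×ₘ≗× k a)

  ×ₘ-ε : ∀ k → _×ₘ_ M k ε ≈ ε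
  ×ₘ-ε zero = ≈-refl
  ×ₘ-ε (suc k) = ≈-trans (∙-congˡ (×ₘ-ε k)) (identityˡ ε)

  ×ₘ-rescale : ∀ j μ {a b} → b ≈ _×ₘ_ M μ a → _×ₘ_ M j b ≈ _×ₘ_ M (μ ℕ.* j) a
  ×ₘ-rescale j μ {a} {b} b≈μa = begin
    _×ₘ_ M j b          ≡⟨ ×ₘ≗× j b ⟩
    j × b               ≈⟨ ×-congʳ j (≈-trans b≈μa (reflexive (×ₘ≗× μ a))) ⟩
    j × (μ × a)         ≈⟨ ×-assocˡ a j μ ⟩
    (j ℕ.* μ) × a       ≡⟨ cong (_× a) (ℕP.*-comm j μ) ⟩
    (μ ℕ.* j) × a       ≡⟨ ×ₘ≗× (μ ℕ.* j) a ⟨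
    _×ₘ_ M (μ ℕ.* j) a  ∎
    where open import Relation.Binary.Reasoning.Setoid setoid

  ≈⇒≈ᵍ : ∀ {a b a' b'} → a ≈ a' → b ≈ b' → _≈ᵍ_ M (a , b) (a' , b')
  ≈⇒≈ᵍ a≈a' b≈b' = ε , ∙-congʳ (∙-cong a≈a' (≈-sym b≈b'))

  ≈ᵍ-trans : ∀ {p q s} → _≈ᵍ_ M p q → _≈ᵍ_ M q s → _≈ᵍ_ M p s
  ≈ᵍ-trans {a , b} {c , d} {e , f} (z , p≈q) (w , q≈s) =
    (c ∙ d) ∙ (z ∙ w) ,
    ≈-trans (solve 6 (λ a f c d z w →
                        (a ⊕ f) ⊕ ((c ⊕ d) ⊕ (z ⊕ w)) ⊜ ((a ⊕ d) ⊕ z) ⊕ ((c ⊕ f) ⊕ w))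
                     ≈-refl a f c d z w)
    (≈-trans (∙-cong p≈q q≈s)
             (solve 6 (λ e b c d z w →
                         ((c ⊕ b) ⊕ z) ⊕ ((e ⊕ d) ⊕ w) ⊜ (e ⊕ b) ⊕ ((c ⊕ d) ⊕ (z ⊕ w)))
                      ≈-refl e b c d z w))

  -ᵍ-self : ∀ p → _≈ᵍ_ M (_-ᵍ_ M p p) (ε , ε)
  -ᵍ-self (a , b) =
    ε , ∙-congʳ (≈-trans (identityʳ _) (≈-trans (comm a b) (≈-sym (identityˡ _))))

  ·ᵍ-ι-rescale : ∀ (z : ℤ) μ {a b} → b ≈ _×ₘ_ M μ a →
    _≈ᵍ_ M (_·ᵍ_ M z (ι M b)) (_·ᵍ_ M (+ μ ℤ.* z) (ι M a))
  ·ᵍ-ι-rescale (+ j) μ b≈μa rewrite sym (ℤP.pos-* μ j) =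
    ≈⇒≈ᵍ (×ₘ-rescale j μ b≈μa) (≈-trans (×ₘ-ε j) (≈-sym (×ₘ-ε (μ ℕ.* j))))
  ·ᵍ-ι-rescale -[1+ j ] μ {a} b≈μa
    rewrite sym (ℤP.neg-distribʳ-* (+ μ) (+ suc j)) | sym (ℤP.pos-* μ (suc j)) =
    negated (μ ℕ.* suc j) (×ₘ-rescale (suc j) μ b≈μa)
    where
    -- ℤ.- (+ t) is + 0 for t = 0 but -[1+ t - 1 ] otherwise.
    negated : ∀ t {b} → _×ₘ_ M (suc j) b ≈ _×ₘ_ M t a →
      _≈ᵍ_ M (_·ᵍ_ M -[1+ j ] (ι M b)) (_·ᵍ_ M (ℤ.- (+ t)) (ι M a))
    negated zero eq = ≈⇒≈ᵍ (×ₘ-ε (suc j)) eq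
    negated (suc t) eq = ≈⇒≈ᵍ (≈-trans (×ₘ-ε (suc j)) (≈-sym (×ₘ-ε (suc t)))) eq

≤-*-pos : ∀ {i} k → + 0 ≤ i → 0 ℕ.< k → i ≤ i ℤ.* + k
≤-*-pos {i} k i≥0 k>0 =
  ℤP.≤-trans (ℤP.≤-reflexive (sym (ℤP.*-identityʳ i)))
             (ℤP.*-monoˡ-≤-nonNeg i {{ℤ.nonNegative i≥0}} (ℤ.+≤+ k>0))

-- Keeps z exactly when e ∈ H_v, so that sumH Γ v f is the sum of restrictH r v e (f e) over all e.
restrictH : ∀ {k} → (Fin k → Fin k) → Fin k → Fin k → ℤ → ℤ
restrictH r v e z = when (r e ≟ v) (unless (e ≟ v) z)

restrictH-zero : ∀ {k} (r : Fin k → Fin k) v e → restrictH r v e (+ 0) ≡ + 0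
restrictH-zero r v e = trans (cong (when (r e ≟ v)) (unless-zero (e ≟ v))) (when-zero (r e ≟ v))

IsLaplacian-cong : ∀ {c ℓ} (M : CommutativeMonoid c ℓ) (Γ : MGraph M) g {D₁ D₂} →
  (∀ v → IsVertex M Γ v → D₁ v ≡ D₂ v) → IsLaplacian M Γ g D₁ → IsLaplacian M Γ g D₂
IsLaplacian-cong M Γ g D₁≡D₂ (s , slopes , D₁≡Δ) =
  s , slopes , λ v v-vertex → trans (sym (D₁≡D₂ v v-vertex)) (D₁≡Δ v v-vertex)

module HarmonicMorphism {c ℓ} (M : CommutativeMonoid c ℓ)
  (Γ Γ' : MGraph M) (φ : Fin (MGraph.n Γ) → Fin (MGraph.n Γ'))
  (morphism : IsMorphism M Γ Γ' φ)
  (μ : Fin (MGraph.n Γ) → ℕ) (slope : IsSlope M Γ Γ' φ μ)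
  (m : Fin (MGraph.n Γ) → ℕ) (harmonic : IsHarmonicWith M Γ Γ' φ μ m)
  where
  open MGraph Γ
  open MGraph Γ' renaming (n to n'; r to r') using ()
  open Groupification M

  φ-vertex : ∀ v → IsVertex M Γ v → IsVertex M Γ' (φ v)
  φ-vertex = proj₁ morphism

  -- φ maps H_v into H'_{φ v}, except for half-edges contracted to a vertex, whose slope is 0.
  restrictH-image : ∀ {v} e → r e ≡ v → e ≢ v → (x : ℤ) →
    restrictH r' (φ v) (φ e) (+ μ e ℤ.* x) ≡ + μ e ℤ.* x
  restrictH-image {v} e re≡v e≢v x with proj₂ morphism e e-half | proj₂ (slope e e-half)
    where
    e-half : IsHalfEdge M Γ e
    e-half re≡e = e≢v (trans (sym re≡e) re≡v)
  ... | inj₁ (φe-half , φre≡r'φe , _ , _) | _ =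
    trans (when-yes (r' (φ e) ≟ φ v) r'φe≡φv)
          (unless-no (φ e ≟ φ v) (λ φe≡φv → φe-half (trans r'φe≡φv (sym φe≡φv))))
    where
    r'φe≡φv : r' (φ e) ≡ φ v
    r'φe≡φv = trans (sym φre≡r'φe) (cong φ re≡v)
  ... | inj₂ (φe-vertex , _ , _) | μe≡0 rewrite μe≡0 φe-vertex = restrictH-zero r' (φ v) (φ e)

  module _ (s' : Fin n' → ℤ) {v} (v-vertex : IsVertex M Γ v) where

    fibreWeight : Fin n → Fin n' → ℤ
    fibreWeight e e' = restrictH r v e (when (φ e ≟ e') (+ μ e))

    harmonic-weight : ∀ e' →
      + m v ℤ.* restrictH r' (φ v) e' (s' e')
        ≡ restrictH r' (φ v) e' (localDeg M Γ Γ' φ μ v e' ℤ.* s' e')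
    harmonic-weight e' with r' e' ≟ φ v | e' ≟ φ v
    ... | yes r'e'≡φv | no e'≢φv = cong (ℤ._* s' e') (sym (harmonic v v-vertex e' e'-half r'e'≡φv))
      where
      e'-half : IsHalfEdge M Γ' e'
      e'-half r'e'≡e' = e'≢φv (trans (sym r'e'≡e') r'e'≡φv)
    ... | yes _ | yes _ = ℤP.*-zeroʳ (+ m v)
    ... | no _ | _ = ℤP.*-zeroʳ (+ m v)

    localDeg-expand : ∀ e' →
      restrictH r' (φ v) e' (localDeg M Γ Γ' φ μ v e' ℤ.* s' e')
        ≡ sum (λ e → restrictH r' (φ v) e' (fibreWeight e e' ℤ.* s' e'))
    localDeg-expand e' = begin
      restrictH r' (φ v) e' (localDeg M Γ Γ' φ μ v e' ℤ.* s' e')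
        ≡⟨ cong (λ t → restrictH r' (φ v) e' (t ℤ.* s' e'))
                (sumFin≗sum (λ e → fibreWeight e e')) ⟩
      restrictH r' (φ v) e' (sum (λ e → fibreWeight e e') ℤ.* s' e')
        ≡⟨ cong (restrictH r' (φ v) e') (*-distribʳ-sum (s' e') (λ e → fibreWeight e e')) ⟩
      restrictH r' (φ v) e' (sum (λ e → fibreWeight e e' ℤ.* s' e'))
        ≡⟨ cong (when (r' e' ≟ φ v)) (unless-sum (e' ≟ φ v) (λ e → fibreWeight e e' ℤ.* s' e')) ⟩
      when (r' e' ≟ φ v) (sum (λ e → unless (e' ≟ φ v) (fibreWeight e e' ℤ.* s' e')))
        ≡⟨ when-sum (r' e' ≟ φ v) (λ e → unless (e' ≟ φ v) (fibreWeight e e' ℤ.* s' e')) ⟩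
      sum (λ e → restrictH r' (φ v) e' (fibreWeight e e' ℤ.* s' e')) ∎
      where open ≡-Reasoning

    fibreWeight-off-image : ∀ e e' → e' ≢ φ e →
      restrictH r' (φ v) e' (fibreWeight e e' ℤ.* s' e') ≡ + 0
    fibreWeight-off-image e e' e'≢φe
      rewrite when-no (φ e ≟ e') {+ μ e} (e'≢φe ∘ sym) | restrictH-zero r v e =
      restrictH-zero r' (φ v) e'

    fibreWeight-at-image : ∀ e (re? : Dec (r e ≡ v)) (e? : Dec (e ≡ v)) →
      restrictH r' (φ v) (φ e) (when re? (unless e? (when (φ e ≟ φ e) (+ μ e))) ℤ.* s' (φ e))
        ≡ when re? (unless e? (+ μ e ℤ.* s' (φ e)))
    fibreWeight-at-image e (yes re≡v) (no e≢v) rewrite when-yes (φ e ≟ φ e) {+ μ e} refl =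
      restrictH-image e re≡v e≢v (s' (φ e))
    fibreWeight-at-image e (yes _) (yes _) = restrictH-zero r' (φ v) (φ e)
    fibreWeight-at-image e (no _) _ = restrictH-zero r' (φ v) (φ e)

    -- Harmonicity: each half-edge at φ v receives total slope m v from the half-edges at v.
    sumH-pullback : sumH M Γ v (λ e → + μ e ℤ.* s' (φ e)) ≡ + m v ℤ.* sumH M Γ' (φ v) s'
    sumH-pullback = sym (begin
      + m v ℤ.* sumH M Γ' (φ v) s'
        ≡⟨ cong (+ m v ℤ.*_) (sumFin≗sum (λ e' → restrictH r' (φ v) e' (s' e'))) ⟩
      + m v ℤ.* sum (λ e' → restrictH r' (φ v) e' (s' e'))
        ≡⟨ *-distribˡ-sum (+ m v) (λ e' → restrictH r' (φ v) e' (s' e')) ⟩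
      sum (λ e' → + m v ℤ.* restrictH r' (φ v) e' (s' e'))
        ≡⟨ sum-cong-≗ (λ e' → trans (harmonic-weight e') (localDeg-expand e')) ⟩
      sum (λ e' → sum (λ e → restrictH r' (φ v) e' (fibreWeight e e' ℤ.* s' e')))
        ≡⟨ ∑-comm (λ e' e → restrictH r' (φ v) e' (fibreWeight e e' ℤ.* s' e')) ⟩
      sum (λ e → sum (λ e' → restrictH r' (φ v) e' (fibreWeight e e' ℤ.* s' e')))
        ≡⟨ sum-cong-≗ (λ e → trans (sum-concentrated (φ e) _ (fibreWeight-off-image e))
                                   (fibreWeight-at-image e (r e ≟ v) (e ≟ v))) ⟩
      sum (λ e → restrictH r v e (+ μ e ℤ.* s' (φ e)))
        ≡⟨ sumFin≗sum (λ e → restrictH r v e (+ μ e ℤ.* s' (φ e))) ⟨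
      sumH M Γ v (λ e → + μ e ℤ.* s' (φ e)) ∎)
      where open ≡-Reasoning

  laplacian-pullback : ∀ g' {D'} →
    IsLaplacian M Γ' g' D' → IsLaplacian M Γ (g' ∘ φ) (pullback M Γ Γ' φ m D')
  laplacian-pullback g' {D'} (s' , slopes' , D'≡Δ) = (λ e → + μ e ℤ.* s' (φ e)) , slopes , D≡Δ
    where
    slopes : ∀ e → IsHalfEdge M Γ e →
      _≈ᵍ_ M (_-ᵍ_ M (g' (φ (r e))) (g' (φ (r (i e)))))
             (_·ᵍ_ M (+ μ e ℤ.* s' (φ e)) (ι M (l e)))
    slopes e e-half with proj₂ morphism e e-half
    ... | inj₁ (φe-half , φre≡r'φe , φrie≡r'i'φe , _) rewrite φre≡r'φe | φrie≡r'i'φe =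
      ≈ᵍ-trans (slopes' (φ e) φe-half)
               (·ᵍ-ι-rescale (s' (φ e)) (μ e) (proj₁ (slope e e-half) φe-half))
    ... | inj₂ (φe-vertex , φre≡φe , φrie≡φe)
      rewrite φre≡φe | φrie≡φe | proj₂ (slope e e-half) φe-vertex =
      -ᵍ-self (g' (φ e))

    D≡Δ : ∀ v → IsVertex M Γ v →
      pullback M Γ Γ' φ m D' v ≡ sumH M Γ v (λ e → + μ e ℤ.* s' (φ e))
    D≡Δ v v-vertex = begin
      D' (φ v) ℤ.* + m v
        ≡⟨ cong (ℤ._* + m v) (D'≡Δ (φ v) (φ-vertex v v-vertex)) ⟩
      sumH M Γ' (φ v) s' ℤ.* + m v
        ≡⟨ ℤP.*-comm _ (+ m v) ⟩
      + m v ℤ.* sumH M Γ' (φ v) s'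
        ≡⟨ sumH-pullback s' v-vertex ⟨
      sumH M Γ v (λ e → + μ e ℤ.* s' (φ e)) ∎
      where open ≡-Reasoning

  pushforward : Div M Γ → Div M Γ'
  pushforward F v' = sum (λ v → when (r v ≟ v) (when (φ v ≟ v') (F v)))

  module _ (F : Div M Γ) (F-eff : Effective M Γ F) where

    pushforward-terms-nonNeg : ∀ v' v → + 0 ≤ when (r v ≟ v) (when (φ v ≟ v') (F v))
    pushforward-terms-nonNeg v' v =
      when-nonNeg (r v ≟ v) (λ v-vertex → when-nonNeg (φ v ≟ v') (λ _ → F-eff v v-vertex))

    pushforward-effective : Effective M Γ' (pushforward F)
    pushforward-effective v' _ = sum-nonNeg _ (pushforward-terms-nonNeg v')

    ≤-pushforward : ∀ v → IsVertex M Γ v → F v ≤ pushforward F (φ v)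
    ≤-pushforward v v-vertex =
      subst (_≤ pushforward F (φ v))
        (trans (when-yes (r v ≟ v) v-vertex) (when-yes (φ v ≟ φ v) refl))
        (≤-sum _ (pushforward-terms-nonNeg (φ v)) v)

  deg-pushforward : ∀ F → deg M Γ' (pushforward F) ≡ deg M Γ F
  deg-pushforward F = begin
    deg M Γ' (pushforward F)
      ≡⟨ sumFin≗sum (λ v' → when (r' v' ≟ v') (pushforward F v')) ⟩
    sum (λ v' → when (r' v' ≟ v') (sum (λ v → term v' v)))
      ≡⟨ sum-cong-≗ (λ v' → when-sum (r' v' ≟ v') (term v')) ⟩
    sum (λ v' → sum (λ v → when (r' v' ≟ v') (term v' v)))
      ≡⟨ ∑-comm (λ v' v → when (r' v' ≟ v') (term v' v)) ⟩
    sum (λ v → sum (λ v' → when (r' v' ≟ v') (term v' v)))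
      ≡⟨ sum-cong-≗ (λ v → trans (sum-concentrated (φ v) _ (off-image v))
                                 (at-image v (r v ≟ v))) ⟩
    sum (λ v → when (r v ≟ v) (F v))
      ≡⟨ sumFin≗sum (λ v → when (r v ≟ v) (F v)) ⟨
    deg M Γ F ∎
    where
    open ≡-Reasoning
    term : Fin n' → Fin n → ℤ
    term v' v = when (r v ≟ v) (when (φ v ≟ v') (F v))

    off-image : ∀ v v' → v' ≢ φ v → when (r' v' ≟ v') (term v' v) ≡ + 0
    off-image v v' v'≢φv
      rewrite when-no (φ v ≟ v') {F v} (v'≢φv ∘ sym) | when-zero (r v ≟ v) = when-zero (r' v' ≟ v')

    at-image : ∀ v (v? : Dec (r v ≡ v)) →
      when (r' (φ v) ≟ φ v) (when v? (when (φ v ≟ φ v) (F v))) ≡ when v? (F v)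
    at-image v (yes v-vertex) rewrite when-yes (φ v ≟ φ v) {F v} refl =
      when-yes (r' (φ v) ≟ φ v) (φ-vertex v v-vertex)
    at-image v (no _) = when-zero (r' (φ v) ≟ φ v)

  rank-pullback : NonDegenerate M Γ Γ' φ m → ∀ D' k →
    RankAtLeast M Γ' D' k → RankAtLeast M Γ (pullback M Γ Γ' φ m D') k
  rank-pullback nondeg D' k rank' F F-eff deg-F≡k =
    lift (rank' (pushforward F) (pushforward-effective F F-eff) (trans (deg-pushforward F) deg-F≡k))
    where
    φ*_ : Div M Γ' → Div M Γ
    φ* D = pullback M Γ Γ' φ m D

    lift : LinSysNonempty M Γ' (λ x → D' x ℤ.- pushforward F x) →
           LinSysNonempty M Γ (λ x → (φ* D') x ℤ.- F x)
    lift (E' , E'-eff , g' , Δg') =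
      E , E-eff , g' ∘ φ , IsLaplacian-cong M Γ (g' ∘ φ) rearrange (laplacian-pullback g' Δg')
      where
      E : Div M Γ
      E v = (φ* E') v ℤ.+ ((φ* pushforward F) v ℤ.- F v)

      E-eff : Effective M Γ E
      E-eff v v-vertex =
        ℤP.+-mono-≤ (ℤP.*-monoʳ-≤-nonNeg (+ m v) (E'-eff (φ v) φv-vertex))
                    (ℤP.i≤j⇒0≤j-i (ℤP.≤-trans (≤-pushforward F F-eff v v-vertex) φ₊F≤φ*φ₊F))
        where
        φv-vertex : IsVertex M Γ' (φ v)
        φv-vertex = φ-vertex v v-vertex

        φ₊F≤φ*φ₊F : pushforward F (φ v) ≤ (φ* pushforward F) v
        φ₊F≤φ*φ₊F = ≤-*-pos (m v) (pushforward-effective F F-eff (φ v) φv-vertex) (nondeg v v-vertex)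

      rearrange : ∀ v → IsVertex M Γ v →
        (φ* (λ x → E' x ℤ.- (D' x ℤ.- pushforward F x))) v ≡ E v ℤ.- ((φ* D') v ℤ.- F v)
      rearrange v _ = ring (E' (φ v)) (D' (φ v)) (pushforward F (φ v)) (F v) (+ m v)
        where
        ring : ∀ (e d f g k : ℤ) →
          (e ℤ.- (d ℤ.- f)) ℤ.* k ≡ (e ℤ.* k ℤ.+ (f ℤ.* k ℤ.- g)) ℤ.- (d ℤ.* k ℤ.- g)
        ring = solve-∀

lemma3p8 : ∀ {c ℓ} (M : CommutativeMonoid c ℓ) → Sharp M → Integral M →
    (Γ Γ' : MGraph M) (φ : Fin (MGraph.n Γ) → Fin (MGraph.n Γ')) →
    IsMorphism M Γ Γ' φ →
    (μ : Fin (MGraph.n Γ) → ℕ) → IsSlope M Γ Γ' φ μ →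
    (m : Fin (MGraph.n Γ) → ℕ) → IsHarmonicWith M Γ Γ' φ μ m → NonDegenerate M Γ Γ' φ m →
    (D' : Div M Γ') → Effective M Γ' D' →
    (ρ ρ' : ℤ) → IsRank M Γ (pullback M Γ Γ' φ m D') ρ → IsRank M Γ' D' ρ' → ρ' ≤ ρ
lemma3p8 M _ _ Γ Γ' φ morphism μ slope m harmonic nondeg D' _ ρ ρ' (_ , ρ-maximal) (rank-ρ' , _) =
  ρ-maximal ρ' (rank-pullback nondeg D' ρ' rank-ρ')
  where open HarmonicMorphism M Γ Γ' φ morphism μ slope m harmonic
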